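{- Let $G$ be a graph of order $m\geq 2$ each of whose connected components is isomorphic to a path $P_i$ for some $1\leq i\leq m$. Let $t$ be the number of components of $G$ having an odd number of vertices. Then $$\alpha(F_2(G))=\frac{m^2+t^2-2t}{4}.$$
   Context: $P_i$ is the path graph on $i$ vertices. For a finite simple graph $G$, the $2$-token graph $F_2(G)$ is the graph whose vertices are the $2$-element subsets of $V(G)$, two such subsets being adjacent iff their symmetric difference is an edge of $G$. $\alpha$ denotes independence number. -}

module Defs where

open import Data.Nat using (ℕ; zero; suc; _+_; _*_; _∸_; _≤_; _<_; _%_)
open import Data.Nat.Properties using (_≟_)
open import Data.Fin using (Fin; toℕ)
import Data.Fin as F
open import Data.List using (List; []; _∷_; length; filter)
open import Data.List.Relation.Unary.Unique.Propositional using (Unique)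
open import Data.List.Relation.Unary.AllPairs using (AllPairs)
open import Data.Product using (Σ; ∃; _×_; _,_; proj₁; proj₂)
open import Data.Sum using (_⊎_)
open import Data.Empty using (⊥)
open import Relation.Nullary using (¬_)
open import Relation.Binary.PropositionalEquality using (_≡_)

Graph : ℕ → Set₁
Graph n = Fin n → Fin n → Set

-- Vertices u, v (natural-number labels) lie in the same block when the
-- vertex set 0,1,…,(sum ls)-1 is cut into consecutive intervals of
-- lengths given by ls.
SameBlock : List ℕ → ℕ → ℕ → Set
SameBlock [] u v = ⊥
SameBlock (i ∷ is) u v =
  (u < i × v < i) ⊎ (i ≤ u × i ≤ v × SameBlock is (u ∸ i) (v ∸ i))

-- The disjoint union P_{i₁} + P_{i₂} + … + P_{i_k} of paths, with
-- ls = i₁ ∷ … ∷ i_k, on the vertex set Fin m (m = i₁ + … + i_k):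
-- the j-th path occupies a consecutive interval of labels, and two
-- vertices are adjacent iff their labels are consecutive and they lie in
-- the same interval.
PathUnion : (m : ℕ) → List ℕ → Graph m
PathUnion m ls u v =
  (suc (toℕ u) ≡ toℕ v ⊎ suc (toℕ v) ≡ toℕ u) × SameBlock ls (toℕ u) (toℕ v)

-- 2-element subsets {a , b} of Fin n, represented with a < b.
Pair2 : ℕ → Set
Pair2 n = Σ (Fin n × Fin n) (λ p → proj₁ p F.< proj₂ p)

_∈₂_ : ∀ {n} → Fin n → Pair2 n → Set
z ∈₂ ((a , b) , _) = z ≡ a ⊎ z ≡ b

_∈SymDiff_,_ : ∀ {n} → Fin n → Pair2 n → Pair2 n → Set
z ∈SymDiff A , B = (z ∈₂ A × ¬ (z ∈₂ B)) ⊎ (z ∈₂ B × ¬ (z ∈₂ A))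

-- The 2-token graph F₂(G): A ~ B iff A △ B = {x , y} for an edge xy of G.
F2 : ∀ {n} → Graph n → Pair2 n → Pair2 n → Set
F2 {n} G A B =
  ∃ λ (x : Fin n) → ∃ λ (y : Fin n) →
    G x y × (∀ z → (z ∈SymDiff A , B → (z ≡ x ⊎ z ≡ y))
                 × ((z ≡ x ⊎ z ≡ y) → z ∈SymDiff A , B))

IsIndependent : {V : Set} → (V → V → Set) → List V → Set
IsIndependent Adj xs = Unique xs × AllPairs (λ u v → ¬ Adj u v × ¬ Adj v u) xs

IsIndependenceNumber : {V : Set} → (V → V → Set) → ℕ → Set
IsIndependenceNumber Adj k =
  (∃ λ xs → IsIndependent Adj xs × length xs ≡ k)
  × (∀ xs → IsIndependent Adj xs → length xs ≤ k)

numOdd : List ℕ → ℕ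
numOdd ls = length (filter (λ i → i % 2 ≟ 1) ls)

-- Label a vertex of G = P_{i₁} + … + P_{i_k} by its path and its position along it, and give a
-- pair {a , b} the weight pos a + pos b, plus 1 when a and b lie on the same path. A step of F₂(G)
-- moves one token one position along its path, so the pairs of even weight form an independent
-- set I. Conversely every odd pair has an even neighbour (move its larger token down, or up, or its
-- smaller token down) from which the odd pair can be read back, so every independent set maps
-- injectively into I and α(F₂(G)) = |I|. If E and O count the vertices at even and odd positions,
-- then E + O = m, E − O = t and a path-by-path count gives 2|I| + t = E² + O², that is,
-- 4|I| + 2t = m² + t².
module Submission where

open import Defs
open import Function using (_∘_; id)
open import Function.Bundles using (Equivalence)
open import Data.Bool using (Bool; true; false; not; T; _∧_; if_then_else_)
open import Data.Bool.Properties using (not-involutive; not-injective; T-≡; T-∧)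
open import Data.Nat using (ℕ; zero; suc; pred; _+_; _*_; _∸_; _≤_; _<_; _<?_; _<ᵇ_; _≡ᵇ_; _%_;
                            z≤n; s≤s; s≤s⁻¹; z<s; s<s; >-nonZero)
open import Data.Nat.Properties
open import Data.Nat.ListAction using (sum)
open import Data.Nat.ListAction.Properties using (sum-++)
open import Data.Nat.Tactic.RingSolver using (solve-∀)
open import Algebra.Properties.CommutativeSemigroup +-commutativeSemigroup
  using () renaming (interchange to +-interchange)
open import Data.Fin using (Fin; toℕ; fromℕ<)
import Data.Fin as Fin
open import Data.Fin.Properties using (toℕ<n; toℕ-fromℕ<; toℕ-injective)
open import Data.List using (List; []; _∷_; _++_; length; filter; map; allFin; tabulate)
open import Data.List.Properties using (length-++; length-map; map-++; map-∘; map-tabulate)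
open import Data.List.Membership.Propositional using (_∈_)
open import Data.List.Membership.Propositional.Properties
  using (∈-∃++; ∈-++⁻; ∈-++⁺ˡ; ∈-++⁺ʳ; ∈-map⁺; ∈-map⁻; ∈-filter⁺; ∈-allFin)
open import Data.List.Relation.Unary.Any using (here; there)
open import Data.List.Relation.Unary.All as All using (All; []; _∷_)
open import Data.List.Relation.Unary.All.Properties using (all-filter)
open import Data.List.Relation.Unary.AllPairs as AllPairs using (AllPairs; []; _∷_)
import Data.List.Relation.Unary.AllPairs.Properties as AllPairs
open import Data.List.Relation.Unary.Unique.Propositional using (Unique)
import Data.List.Relation.Unary.Unique.Propositional.Properties as Unique
open import Data.Product using (∃; _×_; _,_; proj₁; proj₂)
open import Data.Sum using (_⊎_; inj₁; inj₂; [_,_])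
open import Data.Empty using (⊥-elim)
open import Relation.Nullary using (¬_; Dec; yes; no; contradiction)
open import Relation.Nullary.Decidable using (T?)
open import Relation.Unary using (Decidable)
open import Relation.Binary.PropositionalEquality
  using (_≡_; _≢_; refl; sym; trans; cong; cong₂; subst; subst₂; module ≡-Reasoning)

-- Independent sets matched into by their complement

All⇒AllPairs : ∀ {A : Set} {P : A → Set} {R : A → A → Set} → (∀ {x y} → P x → P y → R x y) →
               ∀ {xs} → All P xs → AllPairs R xs
All⇒AllPairs R-P []         = []
All⇒AllPairs R-P (px ∷ pxs) = All.map (R-P px) pxs ∷ All⇒AllPairs R-P pxs

length-≤-Unique-⊆ : ∀ {A : Set} (xs : List A) {ys : List A} → Unique xs → (∀ {x} → x ∈ xs → x ∈ ys) →
                    length xs ≤ length ys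
length-≤-Unique-⊆ []       _            _  = z≤n
length-≤-Unique-⊆ (x ∷ xs) (x∉xs ∷ !xs) xs⊆ with ∈-∃++ (xs⊆ (here refl))
... | ys₁ , ys₂ , refl = subst (suc (length xs) ≤_) (sym length-ys)
                               (s≤s (length-≤-Unique-⊆ xs !xs xs⊆ys₁++ys₂))
  where
  length-ys : length (ys₁ ++ x ∷ ys₂) ≡ suc (length (ys₁ ++ ys₂))
  length-ys = trans (length-++ ys₁) (trans (+-suc (length ys₁) _) (cong suc (sym (length-++ ys₁))))
  xs⊆ys₁++ys₂ : ∀ {y} → y ∈ xs → y ∈ ys₁ ++ ys₂
  xs⊆ys₁++ys₂ y∈xs with ∈-++⁻ ys₁ (xs⊆ (there y∈xs))
  ... | inj₁ y∈ys₁         = ∈-++⁺ˡ y∈ys₁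
  ... | inj₂ (here refl)   = ⊥-elim (All.lookup x∉xs y∈xs refl)
  ... | inj₂ (there y∈ys₂) = ∈-++⁺ʳ ys₁ y∈ys₂

record ComplementMatching {V : Set} (Adj : V → V → Set) (P : V → Set) : Set where
  field
    partner           : ∀ v → ¬ P v → V
    partner-∈         : ∀ v ¬pv → P (partner v ¬pv)
    partner-adjacent  : ∀ v ¬pv → Adj v (partner v ¬pv)
    partner-injective : ∀ u v ¬pu ¬pv → partner u ¬pu ≡ partner v ¬pv → u ≡ v

-- On an independent set, v ↦ (v if P v, else its partner) is injective: an independent set cannot
-- contain both a vertex and its partner, and distinct vertices have distinct partners.
independenceNumber-matched : ∀ {V : Set} {Adj : V → V → Set} {P : V → Set} (P? : Decidable P) →
  (vs : List V) → Unique vs → (∀ v → v ∈ vs) →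
  (∀ {u v} → P u → P v → ¬ Adj u v) → ComplementMatching Adj P →
  IsIndependenceNumber Adj (length (filter P? vs))
independenceNumber-matched {V} {Adj} {P} P? vs !vs complete P-independent matching =
  (filter P? vs , I-independent , refl) , bounded
  where
  open ComplementMatching matching

  I-independent : IsIndependent Adj (filter P? vs)
  I-independent = Unique.filter⁺ P? !vs
                , All⇒AllPairs (λ pu pv → P-independent pu pv , P-independent pv pu) (all-filter P? vs)

  φ : V → V
  φ v with P? v
  ... | yes _   = v
  ... | no  ¬pv = partner v ¬pv

  φ-∈ : ∀ v → P (φ v)
  φ-∈ v with P? v
  ... | yes pv  = pv
  ... | no  ¬pv = partner-∈ v ¬pv

  φ-injective : ∀ {u v} → u ≢ v × ¬ Adj u v × ¬ Adj v u → φ u ≢ φ v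
  φ-injective {u} {v} (u≢v , ¬uv , ¬vu) with P? u | P? v
  ... | yes _   | yes _   = u≢v
  ... | yes _   | no  ¬pv = λ u≡v′ → ¬vu (subst (Adj v) (sym u≡v′) (partner-adjacent v ¬pv))
  ... | no  ¬pu | yes _   = λ u′≡v → ¬uv (subst (Adj u) u′≡v (partner-adjacent u ¬pu))
  ... | no  ¬pu | no  ¬pv = λ u′≡v′ → u≢v (partner-injective u v ¬pu ¬pv u′≡v′)

  bounded : ∀ xs → IsIndependent Adj xs → length xs ≤ length (filter P? vs)
  bounded xs (!xs , xs-independent) =
    subst (_≤ length (filter P? vs)) (length-map φ xs) (length-≤-Unique-⊆ (map φ xs) !φxs φxs⊆I)
    where
    !φxs : Unique (map φ xs)
    !φxs = AllPairs.map⁺ (AllPairs.zipWith φ-injective (!xs , xs-independent))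
    φxs⊆I : ∀ {y} → y ∈ map φ xs → y ∈ filter P? vs
    φxs⊆I y∈ with ∈-map⁻ φ y∈
    ... | x , _ , refl = ∈-filter⁺ P? (complete (φ x)) (φ-∈ x)

-- Moves in the 2-token graph

module _ {n : ℕ} where

  data _≈ₚ_ : Pair2 n → Fin n × Fin n → Set where
    ordered : ∀ {a b a<b} → ((a , b) , a<b) ≈ₚ (a , b)
    swapped : ∀ {a b a<b} → ((a , b) , a<b) ≈ₚ (b , a)

  _∈₂?_ : ∀ z (A : Pair2 n) → Dec (z ∈₂ A)
  z ∈₂? ((a , b) , _) with z Fin.≟ a | z Fin.≟ b
  ... | yes z≡a | _       = yes (inj₁ z≡a)
  ... | no  _   | yes z≡b = yes (inj₂ z≡b)
  ... | no  z≢a | no  z≢b = no [ z≢a , z≢b ]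

  ≈ₚ-∈₂ : ∀ {A x s z} → A ≈ₚ (x , s) → z ∈₂ A → z ≡ x ⊎ z ≡ s
  ≈ₚ-∈₂ ordered z∈A         = z∈A
  ≈ₚ-∈₂ swapped (inj₁ z≡a) = inj₂ z≡a
  ≈ₚ-∈₂ swapped (inj₂ z≡b) = inj₁ z≡b

  ≈ₚ-fst : ∀ {A x s} → A ≈ₚ (x , s) → x ∈₂ A
  ≈ₚ-fst ordered = inj₁ refl
  ≈ₚ-fst swapped = inj₂ refl

  ≈ₚ-snd : ∀ {A x s} → A ≈ₚ (x , s) → s ∈₂ A
  ≈ₚ-snd ordered = inj₂ refl
  ≈ₚ-snd swapped = inj₁ refl

  ∈₂⇒≈ₚ : ∀ {B y s} → y ∈₂ B → s ∈₂ B → y ≢ s → B ≈ₚ (y , s)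
  ∈₂⇒≈ₚ (inj₁ refl) (inj₁ refl) y≢s = ⊥-elim (y≢s refl)
  ∈₂⇒≈ₚ (inj₁ refl) (inj₂ refl) _   = ordered
  ∈₂⇒≈ₚ (inj₂ refl) (inj₁ refl) _   = swapped
  ∈₂⇒≈ₚ (inj₂ refl) (inj₂ refl) y≢s = ⊥-elim (y≢s refl)

  ∈₂-partner : ∀ {A x} → x ∈₂ A → ∃ λ s → A ≈ₚ (x , s) × x ≢ s
  ∈₂-partner {(a , b) , a<b} (inj₁ refl) = b , ordered , λ a≡b → <⇒≢ a<b (cong toℕ a≡b)
  ∈₂-partner {(a , b) , a<b} (inj₂ refl) = a , swapped , λ b≡a → <⇒≢ a<b (cong toℕ (sym b≡a))

  SymDiff-comm : ∀ {A B : Pair2 n} {z} → z ∈SymDiff A , B → z ∈SymDiff B , A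
  SymDiff-comm (inj₁ z∈A∖B) = inj₂ z∈A∖B
  SymDiff-comm (inj₂ z∈B∖A) = inj₁ z∈B∖A

  SymDiff-pair : ∀ A B {x y} → (∀ z → z ∈SymDiff A , B → z ≡ x ⊎ z ≡ y) →
    x ∈₂ A → ¬ x ∈₂ B → y ∈SymDiff A , B → x ≢ y → ∃ λ s → A ≈ₚ (x , s) × B ≈ₚ (y , s)
  SymDiff-pair A B {x} {y} ⊆xy x∈A x∉B y∈A△B x≢y with ∈₂-partner {A} x∈A
  ... | s , A≈xs , x≢s with y∈A△B
  ...   | inj₁ (y∈A , y∉B) = ⊥-elim (B-empty (proj₁ (proj₁ B)) (inj₁ refl))
    where
    y≡s : y ≡ s
    y≡s = [ (λ y≡x → ⊥-elim (x≢y (sym y≡x))) , (λ y≡s → y≡s) ] (≈ₚ-∈₂ A≈xs y∈A)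
    B-empty : ∀ c → ¬ c ∈₂ B
    B-empty c c∈B with c ∈₂? A
    ... | yes c∈A = [ (λ { refl → x∉B c∈B }) , (λ { refl → y∉B (subst (_∈₂ B) (sym y≡s) c∈B) }) ]
                      (≈ₚ-∈₂ A≈xs c∈A)
    ... | no  c∉A = [ (λ { refl → c∉A x∈A }) , (λ { refl → c∉A y∈A }) ] (⊆xy c (inj₂ (c∈B , c∉A)))
  ...   | inj₂ (y∈B , y∉A) with s ∈₂? B
  ...     | yes s∈B = s , A≈xs , ∈₂⇒≈ₚ {B} y∈B s∈B (λ { refl → y∉A (≈ₚ-snd A≈xs) })
  ...     | no  s∉B = ⊥-elim ([ (λ s≡x → x≢s (sym s≡x)) , (λ { refl → y∉A (≈ₚ-snd A≈xs) }) ]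
                                (⊆xy s (inj₁ (≈ₚ-snd A≈xs , s∉B))))

  F2⇒move : (G : Graph n) → (∀ x → ¬ G x x) → ∀ {A B} → F2 G A B →
    ∃ λ u → ∃ λ v → ∃ λ s → (G u v ⊎ G v u) × A ≈ₚ (u , s) × B ≈ₚ (v , s)
  F2⇒move G irrefl {A} {B} (x , y , Gxy , A△B≡xy) with proj₂ (A△B≡xy x) (inj₁ refl)
  ... | inj₁ (x∈A , x∉B) with SymDiff-pair A B (λ z → proj₁ (A△B≡xy z)) x∈A x∉B y∈A△B x≢y
    where
    x≢y : x ≢ y
    x≢y refl = irrefl x Gxy
    y∈A△B = proj₂ (A△B≡xy y) (inj₂ refl)
  ...   | s , A≈xs , B≈ys = x , y , s , inj₁ Gxy , A≈xs , B≈ys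
  F2⇒move G irrefl {A} {B} (x , y , Gxy , A△B≡xy)
      | inj₂ (x∈B , x∉A)
      with SymDiff-pair B A (λ z z∈ → proj₁ (A△B≡xy z) (SymDiff-comm {B} {A} z∈)) x∈B x∉A y∈B△A x≢y
    where
    x≢y : x ≢ y
    x≢y refl = irrefl x Gxy
    y∈B△A = SymDiff-comm {A} {B} (proj₂ (A△B≡xy y) (inj₂ refl))
  ...   | s , B≈xs , A≈ys = y , x , s , inj₂ Gxy , A≈ys , B≈xs

  move⇒F2 : (G : Graph n) → ∀ {A B x y s} → G x y → A ≈ₚ (x , s) → B ≈ₚ (y , s) →
            x ≢ y → x ≢ s → y ≢ s → F2 G A B
  move⇒F2 G {A} {B} {x} {y} {s} Gxy A≈xs B≈ys x≢y x≢s y≢s = x , y , Gxy , λ z → ⊆xy z , xy⊆ z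
    where
    ⊆xy : ∀ z → z ∈SymDiff A , B → z ≡ x ⊎ z ≡ y
    ⊆xy z (inj₁ (z∈A , z∉B)) =
      [ inj₁ , (λ { refl → ⊥-elim (z∉B (≈ₚ-snd B≈ys)) }) ] (≈ₚ-∈₂ A≈xs z∈A)
    ⊆xy z (inj₂ (z∈B , z∉A)) =
      [ inj₂ , (λ { refl → ⊥-elim (z∉A (≈ₚ-snd A≈xs)) }) ] (≈ₚ-∈₂ B≈ys z∈B)
    xy⊆ : ∀ z → z ≡ x ⊎ z ≡ y → z ∈SymDiff A , B
    xy⊆ z (inj₁ refl) = inj₁ (≈ₚ-fst A≈xs , λ x∈B → [ x≢y , x≢s ] (≈ₚ-∈₂ B≈ys x∈B))
    xy⊆ z (inj₂ refl) =
      inj₂ (≈ₚ-fst B≈ys , λ y∈A → [ (λ y≡x → x≢y (sym y≡x)) , y≢s ] (≈ₚ-∈₂ A≈xs y∈A))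

even odd : ℕ → Bool
even zero    = true
even (suc n) = not (even n)
odd n = not (even n)

𝟙 : Bool → ℕ
𝟙 true  = 1
𝟙 false = 0

even-suc-suc : ∀ n → even (suc (suc n)) ≡ even n
even-suc-suc n = not-involutive (even n)

even-+ : ∀ m n → even (m + n) ≡ (if even m then even n else odd n)
even-+ zero    n = refl
even-+ (suc m) n rewrite even-+ m n with even m
... | true  = refl
... | false = not-involutive (even n)

even-+-even : ∀ m {n} → even n ≡ true → even (m + n) ≡ even m
even-+-even m {n} even-n rewrite even-+ m n | even-n with even m
... | true  = refl
... | false = refl

𝟙-even-+ : ∀ m n → 𝟙 (even (m + n)) ≡ 𝟙 (even m) * 𝟙 (even n) + 𝟙 (odd m) * 𝟙 (odd n)
𝟙-even-+ m n rewrite even-+ m n with even m | even n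
... | true  | true  = refl
... | true  | false = refl
... | false | true  = refl
... | false | false = refl

even-+-self : ∀ n → even (n + n) ≡ true
even-+-self zero    = refl
even-+-self (suc n) rewrite +-suc n n = trans (even-suc-suc (n + n)) (even-+-self n)

even-+-suc-+-1 : ∀ n → even (n + suc n + 1) ≡ true
even-+-suc-+-1 n = trans (cong even (regroup n)) (even-+-self (suc n))
  where
  regroup : ∀ n → n + suc n + 1 ≡ suc n + suc n
  regroup = solve-∀

odd⇒0< : ∀ {n} → even n ≡ false → 0 < n
odd⇒0< {suc n} _ = z<s

%2≡𝟙-odd : ∀ n → n % 2 ≡ 𝟙 (odd n)
%2≡𝟙-odd zero          = refl
%2≡𝟙-odd (suc zero)    = refl
%2≡𝟙-odd (suc (suc n)) = trans (%2≡𝟙-odd n) (cong (λ b → 𝟙 (not b)) (sym (even-suc-suc n)))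

numOdd-∷ : ∀ i is → numOdd (i ∷ is) ≡ 𝟙 (odd i) + numOdd is
numOdd-∷ i is rewrite %2≡𝟙-odd i with odd i
... | true  = refl
... | false = refl

¬T⇒≡false : ∀ {x} → ¬ T x → x ≡ false
¬T⇒≡false {true}  ¬tt = contradiction _ ¬tt
¬T⇒≡false {false} _   = refl

T-≡-not : ∀ {x y} → x ≡ not y → T x → ¬ T y
T-≡-not {true} {true} ()

T-not-false : ∀ {x y} → x ≡ not y → x ≡ false → T y
T-not-false {y = true}  _    _  = _
T-not-false {y = false} refl ()

≡ᵇ-comm : ∀ m n → (m ≡ᵇ n) ≡ (n ≡ᵇ m)
≡ᵇ-comm zero    zero    = refl
≡ᵇ-comm zero    (suc n) = refl
≡ᵇ-comm (suc m) zero    = refl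
≡ᵇ-comm (suc m) (suc n) = ≡ᵇ-comm m n

≡⇒≡ᵇ-true : ∀ {m n} → m ≡ n → (m ≡ᵇ n) ≡ true
≡⇒≡ᵇ-true {m} {n} m≡n = Equivalence.to T-≡ (≡⇒≡ᵇ m n m≡n)

≢⇒≡ᵇ-false : ∀ {m n} → m ≢ n → (m ≡ᵇ n) ≡ false
≢⇒≡ᵇ-false {m} {n} m≢n = ¬T⇒≡false (m≢n ∘ ≡ᵇ⇒≡ m n)

sumTo : ℕ → (ℕ → ℕ) → ℕ
sumTo zero    f = 0
sumTo (suc n) f = f 0 + sumTo n (λ k → f (suc k))

sumTo-cong : ∀ n {f g : ℕ → ℕ} → (∀ {k} → k < n → f k ≡ g k) → sumTo n f ≡ sumTo n g
sumTo-cong zero    eq = refl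
sumTo-cong (suc n) eq = cong₂ _+_ (eq z<s) (sumTo-cong n (λ k<n → eq (s<s k<n)))

sumTo-split : ∀ m n f → sumTo (m + n) f ≡ sumTo m f + sumTo n (λ k → f (m + k))
sumTo-split zero    n f = refl
sumTo-split (suc m) n f =
  trans (cong (f 0 +_) (sumTo-split m n (λ k → f (suc k)))) (sym (+-assoc (f 0) _ _))

sumTo-+ : ∀ n f g → sumTo n (λ k → f k + g k) ≡ sumTo n f + sumTo n g
sumTo-+ zero    f g = refl
sumTo-+ (suc n) f g rewrite sumTo-+ n (λ k → f (suc k)) (λ k → g (suc k)) =
  +-interchange (f 0) (g 0) _ _

sumTo-*ˡ : ∀ n c f → sumTo n (λ k → c * f k) ≡ c * sumTo n f
sumTo-*ˡ zero    c f = sym (*-zeroʳ c)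
sumTo-*ˡ (suc n) c f rewrite sumTo-*ˡ n c (λ k → f (suc k)) = sym (*-distribˡ-+ c (f 0) _)

sumTo-*ʳ : ∀ n c f → sumTo n (λ k → f k * c) ≡ sumTo n f * c
sumTo-*ʳ n c f = trans (sumTo-cong n (λ {k} _ → *-comm (f k) c)) (trans (sumTo-*ˡ n c f) (*-comm c _))

sumTo-𝟙+𝟙-not : ∀ n (b : ℕ → Bool) → sumTo n (λ k → 𝟙 (b k)) + sumTo n (λ k → 𝟙 (not (b k))) ≡ n
sumTo-𝟙+𝟙-not zero    b = refl
sumTo-𝟙+𝟙-not (suc n) b with sumTo-𝟙+𝟙-not n (λ k → b (suc k)) | b 0
... | ih | true  = cong suc ih
... | ih | false = trans (+-suc _ _) (cong suc ih)

countPairs : ℕ → (ℕ → ℕ → Bool) → ℕ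
countPairs zero    Q = 0
countPairs (suc n) Q = sumTo n (λ b → 𝟙 (Q 0 (suc b))) + countPairs n (λ a b → Q (suc a) (suc b))

countPairs-cong : ∀ n {Q Q′ : ℕ → ℕ → Bool} → (∀ {a b} → a < b → b < n → Q a b ≡ Q′ a b) →
                  countPairs n Q ≡ countPairs n Q′
countPairs-cong zero    eq = refl
countPairs-cong (suc n) eq =
  cong₂ _+_ (sumTo-cong n (λ b<n → cong 𝟙 (eq z<s (s<s b<n))))
            (countPairs-cong n (λ a<b b<n → eq (s<s a<b) (s<s b<n)))

countPairs-split : ∀ m n Q → countPairs (m + n) Q ≡
  countPairs m Q + sumTo m (λ a → sumTo n (λ b → 𝟙 (Q a (m + b)))) + countPairs n (λ a b → Q (m + a) (m + b))
countPairs-split zero    n Q = refl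
countPairs-split (suc m) n Q =
  trans (cong₂ _+_ (sumTo-split m n (λ b → 𝟙 (Q 0 (suc b))))
                   (countPairs-split m n (λ a b → Q (suc a) (suc b))))
        (regroup (sumTo m (λ b → 𝟙 (Q 0 (suc b)))) _ (countPairs m (λ a b → Q (suc a) (suc b))) _ _)
  where
  regroup : ∀ a b c d e → a + b + (c + d + e) ≡ a + c + (b + d) + e
  regroup = solve-∀

withZero : ∀ {m} → Fin m → Pair2 (suc m)
withZero b = (Fin.zero , Fin.suc b) , z<s

shift : ∀ {m} → Pair2 m → Pair2 (suc m)
shift ((a , b) , a<b) = (Fin.suc a , Fin.suc b) , s<s a<b

allPairs : ∀ m → List (Pair2 m)
allPairs zero    = []
allPairs (suc m) = map withZero (allFin m) ++ map shift (allPairs m)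

allPairs-Unique : ∀ m → Unique (allPairs m)
allPairs-Unique zero    = AllPairs.[]
allPairs-Unique (suc m) =
  Unique.++⁺ (Unique.map⁺ withZero-injective (Unique.allFin⁺ m))
             (Unique.map⁺ shift-injective (allPairs-Unique m)) disjoint
  where
  withZero-injective : ∀ {x y : Fin m} → withZero x ≡ withZero y → x ≡ y
  withZero-injective refl = refl
  shift-injective : ∀ {A B : Pair2 m} → shift A ≡ shift B → A ≡ B
  shift-injective {(a , b) , _} {(a′ , b′) , _} refl = refl
  disjoint : ∀ {A} → ¬ (A ∈ map withZero (allFin m) × A ∈ map shift (allPairs m))
  disjoint (A∈ , A∈′) with ∈-map⁻ withZero A∈ | ∈-map⁻ shift A∈′
  ... | _ , _ , refl | _ , _ , ()

∈-allPairs : ∀ m (A : Pair2 m) → A ∈ allPairs m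
∈-allPairs (suc m) ((Fin.zero  , Fin.suc b) , s<s z≤n) = ∈-++⁺ˡ (∈-map⁺ withZero (∈-allFin b))
∈-allPairs (suc m) ((Fin.suc a , Fin.suc b) , s<s a<b) =
  ∈-++⁺ʳ (map withZero (allFin m)) (∈-map⁺ shift (∈-allPairs m ((a , b) , a<b)))

onLabels : ∀ {m} → (ℕ → ℕ → Bool) → Pair2 m → Bool
onLabels Q ((a , b) , _) = Q (toℕ a) (toℕ b)

length-filter-T : ∀ {A : Set} (q : A → Bool) xs → length (filter (T? ∘ q) xs) ≡ sum (map (𝟙 ∘ q) xs)
length-filter-T q []       = refl
length-filter-T q (x ∷ xs) with q x
... | true  = cong suc (length-filter-T q xs)
... | false = length-filter-T q xs

sum-map-allFin : ∀ m (f : ℕ → ℕ) → sum (map (f ∘ toℕ) (allFin m)) ≡ sumTo m f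
sum-map-allFin zero    f = refl
sum-map-allFin (suc m) f = cong (f 0 +_) (trans (cong sum allFin-suc) (sum-map-allFin m (f ∘ suc)))
  where
  allFin-suc : map (f ∘ toℕ) (tabulate {n = m} Fin.suc) ≡ map (f ∘ suc ∘ toℕ) (allFin m)
  allFin-suc = trans (map-tabulate Fin.suc (f ∘ toℕ)) (sym (map-tabulate id (f ∘ suc ∘ toℕ)))

length-filter-allPairs : ∀ m Q → length (filter (T? ∘ onLabels Q) (allPairs m)) ≡ countPairs m Q
length-filter-allPairs m Q = trans (length-filter-T (onLabels Q) (allPairs m)) (go m Q)
  where
  go : ∀ m Q → sum (map (𝟙 ∘ onLabels Q) (allPairs m)) ≡ countPairs m Q
  go zero    Q = refl
  go (suc m) Q = begin
    sum (map (𝟙 ∘ onLabels Q) (map withZero (allFin m) ++ map shift (allPairs m)))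
      ≡⟨ cong sum (map-++ (𝟙 ∘ onLabels Q) (map withZero (allFin m)) _) ⟩
    sum (map (𝟙 ∘ onLabels Q) (map withZero (allFin m)) ++ map (𝟙 ∘ onLabels Q) (map shift (allPairs m)))
      ≡⟨ sum-++ (map (𝟙 ∘ onLabels Q) (map withZero (allFin m))) _ ⟩
    sum (map (𝟙 ∘ onLabels Q) (map withZero (allFin m))) + sum (map (𝟙 ∘ onLabels Q) (map shift (allPairs m)))
      ≡⟨ cong₂ _+_ (cong sum (sym (map-∘ (allFin m)))) (cong sum (sym (map-∘ (allPairs m)))) ⟩
    sum (map (𝟙 ∘ onLabels Q ∘ withZero) (allFin m)) + sum (map (𝟙 ∘ onLabels Q ∘ shift) (allPairs m))
      ≡⟨ cong₂ _+_ (sum-map-allFin m (λ b → 𝟙 (Q 0 (suc b)))) (go m (λ a b → Q (suc a) (suc b))) ⟩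
    countPairs (suc m) Q ∎
    where open ≡-Reasoning

-- Even-weight pairs within one path

evensBelow oddsBelow : ℕ → ℕ
evensBelow n = sumTo n (λ k → 𝟙 (even k))
oddsBelow  n = sumTo n (λ k → 𝟙 (odd k))

oddsBelow-suc : ∀ n → oddsBelow (suc n) ≡ evensBelow n
oddsBelow-suc n = sumTo-cong n (λ {k} _ → cong 𝟙 (even-suc-suc k))

evensBelow≡oddsBelow+𝟙-odd : ∀ n → evensBelow n ≡ oddsBelow n + 𝟙 (odd n)
evensBelow≡oddsBelow+𝟙-odd zero    = refl
evensBelow≡oddsBelow+𝟙-odd (suc n) with even n | evensBelow≡oddsBelow+𝟙-odd n
... | true  | ih = sym (trans (cong (_+ 1) (trans (oddsBelow-suc n) (trans ih (+-identityʳ _)))) (+-comm _ 1))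
... | false | ih = sym (trans (+-identityʳ _) (trans (oddsBelow-suc n) (trans ih (+-comm _ 1))))

evenWeightPathPairs : ℕ → ℕ
evenWeightPathPairs n = countPairs n (λ a b → even (a + b + 1))

evenWeightPathPairs-suc : ∀ n → evenWeightPathPairs (suc n) ≡ evensBelow n + evenWeightPathPairs n
evenWeightPathPairs-suc n = cong₂ _+_
  (sumTo-cong n (λ {b} _ → cong 𝟙 (trans (cong (λ x → even (suc x)) (+-comm b 1)) (even-suc-suc b))))
  (countPairs-cong n (λ {a} {b} _ _ → trans (cong (λ x → even (suc (x + 1))) (+-suc a b))
                                            (even-suc-suc (a + b + 1))))

evenWeightPathPairs≡evens*odds : ∀ n → evenWeightPathPairs n ≡ evensBelow n * oddsBelow n
evenWeightPathPairs≡evens*odds zero    = refl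
evenWeightPathPairs≡evens*odds (suc n) = begin
  evenWeightPathPairs (suc n)            ≡⟨ evenWeightPathPairs-suc n ⟩
  evensBelow n + evenWeightPathPairs n   ≡⟨ cong (evensBelow n +_) (evenWeightPathPairs≡evens*odds n) ⟩
  evensBelow n + evensBelow n * oddsBelow n ≡⟨ cong (evensBelow n +_) (*-comm (evensBelow n) _) ⟩
  suc (oddsBelow n) * evensBelow n       ≡⟨ cong (suc (oddsBelow n) *_) (sym (oddsBelow-suc n)) ⟩
  evensBelow (suc n) * oddsBelow (suc n) ∎
  where open ≡-Reasoning

-- Paths as blocks of consecutive labels

-- Label v lies on path number block ls v, at position offset ls v along it.
block offset : List ℕ → ℕ → ℕ
block []       v = 0
block (i ∷ is) v with v <? i
... | yes _ = 0
... | no  _ = suc (block is (v ∸ i))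
offset []       v = v
offset (i ∷ is) v with v <? i
... | yes _ = v
... | no  _ = offset is (v ∸ i)

module _ {i : ℕ} {is : List ℕ} {v : ℕ} where

  block-< : v < i → block (i ∷ is) v ≡ 0
  block-< v<i with v <? i
  ... | yes _   = refl
  ... | no  v≮i = contradiction v<i v≮i

  offset-< : v < i → offset (i ∷ is) v ≡ v
  offset-< v<i with v <? i
  ... | yes _   = refl
  ... | no  v≮i = contradiction v<i v≮i

  block-≥ : i ≤ v → block (i ∷ is) v ≡ suc (block is (v ∸ i))
  block-≥ i≤v with v <? i
  ... | yes v<i = contradiction i≤v (<⇒≱ v<i)
  ... | no  _   = refl

  offset-≥ : i ≤ v → offset (i ∷ is) v ≡ offset is (v ∸ i)
  offset-≥ i≤v with v <? i
  ... | yes v<i = contradiction i≤v (<⇒≱ v<i)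
  ... | no  _   = refl

block-+ : ∀ i is w → block (i ∷ is) (i + w) ≡ suc (block is w)
block-+ i is w = trans (block-≥ (m≤m+n i w)) (cong (λ u → suc (block is u)) (m+n∸m≡n i w))

offset-+ : ∀ i is w → offset (i ∷ is) (i + w) ≡ offset is w
offset-+ i is w = trans (offset-≥ (m≤m+n i w)) (cong (offset is) (m+n∸m≡n i w))

block-<≢block-+ : ∀ {i is a} w → a < i → block (i ∷ is) a ≢ block (i ∷ is) (i + w)
block-<≢block-+ {i} {is} w a<i eq = 0≢1+n (trans (sym (block-< a<i)) (trans eq (block-+ i is w)))

<+⇒∸< : ∀ {u i s} → i ≤ u → u < i + s → u ∸ i < s
<+⇒∸< {u} {i} {s} i≤u u<i+s = subst (u ∸ i <_) (m+n∸m≡n i s) (∸-monoˡ-< u<i+s i≤u)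

∸<⇒<+ : ∀ {u i s} → i ≤ u → u ∸ i < s → u < i + s
∸<⇒<+ {u} {i} {s} i≤u u∸i<s = subst (_< i + s) (m+[n∸m]≡n i≤u) (+-monoʳ-< i u∸i<s)

SameBlock⇒block≡ : ∀ ls {u v} → SameBlock ls u v → u < sum ls × v < sum ls × block ls u ≡ block ls v
SameBlock⇒block≡ (i ∷ is) (inj₁ (u<i , v<i)) =
  ≤-trans u<i (m≤m+n i _) , ≤-trans v<i (m≤m+n i _) , trans (block-< u<i) (sym (block-< v<i))
SameBlock⇒block≡ (i ∷ is) (inj₂ (i≤u , i≤v , same)) with SameBlock⇒block≡ is same
... | u< , v< , eq =
  ∸<⇒<+ i≤u u< , ∸<⇒<+ i≤v v< , trans (block-≥ i≤u) (trans (cong suc eq) (sym (block-≥ i≤v)))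

block≡⇒SameBlock : ∀ ls {u v} → u < sum ls → v < sum ls → block ls u ≡ block ls v → SameBlock ls u v
block≡⇒SameBlock (i ∷ is) {u} {v} u< v< eq with u <? i | v <? i
... | yes u<i | yes v<i = inj₁ (u<i , v<i)
... | yes _   | no  _   = contradiction eq 0≢1+n
... | no  _   | yes _   = contradiction (sym eq) 0≢1+n
... | no  u≮i | no  v≮i = inj₂ (≮⇒≥ u≮i , ≮⇒≥ v≮i ,
  block≡⇒SameBlock is (<+⇒∸< (≮⇒≥ u≮i) u<) (<+⇒∸< (≮⇒≥ v≮i) v<) (suc-injective eq))

offset-translate : ∀ ls {a b} → block ls a ≡ block ls b → a + offset ls b ≡ b + offset ls a
offset-translate []       {a} {b} _ = +-comm a b
offset-translate (i ∷ is) {a} {b} eq with a <? i | b <? i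
... | yes _   | yes _   = +-comm a b
... | yes _   | no  _   = contradiction eq 0≢1+n
... | no  _   | yes _   = contradiction (sym eq) 0≢1+n
... | no  a≮i | no  b≮i = begin
  a + offset is (b ∸ i)             ≡⟨ cong (_+ offset is (b ∸ i)) (sym (m+[n∸m]≡n (≮⇒≥ a≮i))) ⟩
  i + (a ∸ i) + offset is (b ∸ i)   ≡⟨ +-assoc i _ _ ⟩
  i + ((a ∸ i) + offset is (b ∸ i)) ≡⟨ cong (i +_) (offset-translate is (suc-injective eq)) ⟩
  i + ((b ∸ i) + offset is (a ∸ i)) ≡⟨ sym (+-assoc i _ _) ⟩
  i + (b ∸ i) + offset is (a ∸ i)   ≡⟨ cong (_+ offset is (a ∸ i)) (m+[n∸m]≡n (≮⇒≥ b≮i)) ⟩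
  b + offset is (a ∸ i)             ∎
  where open ≡-Reasoning

offset-suc : ∀ ls {u} → block ls u ≡ block ls (suc u) → offset ls (suc u) ≡ suc (offset ls u)
offset-suc ls {u} eq = +-cancelˡ-≡ u _ _ (trans (offset-translate ls eq) (sym (+-suc u _)))

offset-suc⁻¹ : ∀ ls {v p} → offset ls v ≡ suc p →
              ∃ λ w → v ≡ suc w × block ls w ≡ block ls v × offset ls w ≡ p
offset-suc⁻¹ []       {v} {p} eq = p , eq , refl , refl
offset-suc⁻¹ (i ∷ is) {v} {p} eq with v <? i
... | yes v<i = p , eq , block-< {is = is} p<i , offset-< {is = is} p<i
  where
  p<i : p < i
  p<i = <-trans (subst (p <_) (sym eq) (n<1+n p)) v<i
... | no  v≮i with offset-suc⁻¹ is eq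
...   | w , v∸i≡1+w , same , off =
  i + w , v≡i+1+w , trans (block-+ i is w) (cong suc same) , trans (offset-+ i is w) off
  where
  v≡i+1+w : v ≡ suc (i + w)
  v≡i+1+w = trans (sym (m+[n∸m]≡n (≮⇒≥ v≮i))) (trans (cong (i +_) v∸i≡1+w) (+-suc i w))

-- The even-weight pairs of F₂(P_{i₁} + … + P_{i_k}) and their matching

weight : List ℕ → ℕ → ℕ → ℕ
weight ls a b = offset ls a + offset ls b + 𝟙 (block ls a ≡ᵇ block ls b)

weight-comm : ∀ ls a b → weight ls a b ≡ weight ls b a
weight-comm ls a b = cong₂ _+_ (+-comm (offset ls a) _) (cong 𝟙 (≡ᵇ-comm (block ls a) _))

weight-step : ∀ ls {u v} → block ls u ≡ block ls v → offset ls v ≡ suc (offset ls u) →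
              ∀ s → weight ls v s ≡ suc (weight ls u s)
weight-step ls same next s rewrite next | same = refl

module _ {m : ℕ} (ls : List ℕ) where

  PathUnion-irreflexive : ∀ u → ¬ PathUnion m ls u u
  PathUnion-irreflexive u (inj₁ 1+u≡u , _) = 1+n≢n 1+u≡u
  PathUnion-irreflexive u (inj₂ 1+u≡u , _) = 1+n≢n 1+u≡u

  PathUnion⇒step : ∀ {u v} → PathUnion m ls u v → block ls (toℕ u) ≡ block ls (toℕ v) ×
    (offset ls (toℕ v) ≡ suc (offset ls (toℕ u)) ⊎ offset ls (toℕ u) ≡ suc (offset ls (toℕ v)))
  PathUnion⇒step {u} {v} (inj₁ 1+u≡v , sb) with SameBlock⇒block≡ ls sb
  ... | _ , _ , same = same , inj₁ (subst (λ w → offset ls w ≡ suc (offset ls (toℕ u))) 1+u≡v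
                                          (offset-suc ls (trans same (cong (block ls) (sym 1+u≡v)))))
  PathUnion⇒step {u} {v} (inj₂ 1+v≡u , sb) with SameBlock⇒block≡ ls sb
  ... | _ , _ , same = same , inj₂ (subst (λ w → offset ls w ≡ suc (offset ls (toℕ v))) 1+v≡u
                                          (offset-suc ls (trans (sym same) (cong (block ls) (sym 1+v≡u)))))

  PathUnion-parity : ∀ {u v} → PathUnion m ls u v →
                     ∀ s → even (weight ls (toℕ u) s) ≡ not (even (weight ls (toℕ v) s))
  PathUnion-parity uv s with PathUnion⇒step uv
  ... | same , inj₁ next = sym (trans (cong (not ∘ even) (weight-step ls same next s)) (not-involutive _))
  ... | same , inj₂ next = cong even (weight-step ls (sym same) next s)

toℕ-≢ : ∀ {n} {x y : Fin n} → toℕ x ≢ toℕ y → x ≢ y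
toℕ-≢ x≢y refl = x≢y refl

module PathUnionTokens (ls : List ℕ) where

  M : ℕ
  M = sum ls

  G : Graph M
  G = PathUnion M ls

  low high : Pair2 M → ℕ
  low  ((a , _) , _) = toℕ a
  high ((_ , b) , _) = toℕ b

  evenWeight : ℕ → ℕ → Bool
  evenWeight a b = even (weight ls a b)

  EvenPair : Pair2 M → Set
  EvenPair A = T (onLabels evenWeight A)

  ≈ₚ-weight : ∀ {A x s} → A ≈ₚ (x , s) → weight ls (low A) (high A) ≡ weight ls (toℕ x) (toℕ s)
  ≈ₚ-weight ordered            = refl
  ≈ₚ-weight (swapped {a} {b}) = weight-comm ls (toℕ a) (toℕ b)

  EvenPair-independent : ∀ {A B} → EvenPair A → EvenPair B → ¬ F2 G A B
  EvenPair-independent {A} {B} evenA evenB A~B with F2⇒move G (PathUnion-irreflexive ls) A~B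
  ... | u , v , s , inj₁ uv , A≈us , B≈vs =
    T-≡-not (PathUnion-parity ls uv (toℕ s)) (subst (T ∘ even) (≈ₚ-weight {A} A≈us) evenA)
                                              (subst (T ∘ even) (≈ₚ-weight {B} B≈vs) evenB)
  ... | u , v , s , inj₂ vu , A≈us , B≈vs =
    T-≡-not (PathUnion-parity ls vu (toℕ s)) (subst (T ∘ even) (≈ₚ-weight {B} B≈vs) evenB)
                                              (subst (T ∘ even) (≈ₚ-weight {A} A≈us) evenA)

  hasNext : ℕ → Bool
  hasNext d = (suc d <ᵇ M) ∧ (block ls (suc d) ≡ᵇ block ls d)

  -- Inverse of the partner map below: the shape of an even partner (c , d) tells which token moved.
  recover : ℕ → ℕ → ℕ × ℕ
  recover c d =
    if block ls c ≡ᵇ block ls d then (c , suc d)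
    else if odd (offset ls d) then (c , pred d)
    else if hasNext d then (c , suc d)
    else (suc c , d)

  record Partner (A : Pair2 M) : Set where
    field
      pair     : Pair2 M
      isEven   : EvenPair pair
      adjacent : F2 G A pair
      recovers : recover (low pair) (high pair) ≡ (low A , high A)

  consecutive⇒G : ∀ {u v : Fin M} → suc (toℕ u) ≡ toℕ v ⊎ suc (toℕ v) ≡ toℕ u →
                  block ls (toℕ u) ≡ block ls (toℕ v) → G u v
  consecutive⇒G {u} {v} step same = step , block≡⇒SameBlock ls (toℕ<n u) (toℕ<n v) same

  highMove : ∀ {a b b′} (a<b : toℕ a < toℕ b) (a<b′ : toℕ a < toℕ b′) → G b b′ →
             evenWeight (toℕ a) (toℕ b) ≡ false → recover (toℕ a) (toℕ b′) ≡ (toℕ a , toℕ b) →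
             Partner ((a , b) , a<b)
  highMove {a} {b} {b′} a<b a<b′ bb′ odd-ab recovers = record
    { pair     = (a , b′) , a<b′
    ; isEven   = T-not-false (subst₂ (λ x y → even x ≡ not (even y)) (weight-comm ls _ _) (weight-comm ls _ _)
                                     (PathUnion-parity ls bb′ (toℕ a)))
                             odd-ab
    ; adjacent = move⇒F2 G {(a , b) , a<b} {(a , b′) , a<b′} bb′ swapped swapped
                         (λ { refl → PathUnion-irreflexive ls b bb′ })
                         (toℕ-≢ (<⇒≢ a<b ∘ sym)) (toℕ-≢ (<⇒≢ a<b′ ∘ sym))
    ; recovers = recovers
    }

  lowMove : ∀ {a a′ b} (a<b : toℕ a < toℕ b) (a′<b : toℕ a′ < toℕ b) → G a a′ →
            evenWeight (toℕ a) (toℕ b) ≡ false → recover (toℕ a′) (toℕ b) ≡ (toℕ a , toℕ b) →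
            Partner ((a , b) , a<b)
  lowMove {a} {a′} {b} a<b a′<b aa′ odd-ab recovers = record
    { pair     = (a′ , b) , a′<b
    ; isEven   = T-not-false (PathUnion-parity ls aa′ (toℕ b)) odd-ab
    ; adjacent = move⇒F2 G {(a , b) , a<b} {(a′ , b) , a′<b} aa′ ordered ordered
                         (λ { refl → PathUnion-irreflexive ls a aa′ })
                         (toℕ-≢ (<⇒≢ a<b)) (toℕ-≢ (<⇒≢ a′<b))
    ; recovers = recovers
    }

  lowerHigh : ∀ {a b} (a<b : toℕ a < toℕ b) → evenWeight (toℕ a) (toℕ b) ≡ false →
    (w : Fin M) → suc (toℕ w) ≡ toℕ b → block ls (toℕ w) ≡ block ls (toℕ b) → toℕ a ≢ toℕ w →
    recover (toℕ a) (toℕ w) ≡ (toℕ a , suc (toℕ w)) → Partner ((a , b) , a<b)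
  lowerHigh {a} a<b odd-ab w 1+w≡b same a≢w recovers =
    highMove a<b a<w (consecutive⇒G (inj₂ 1+w≡b) (sym same)) odd-ab (trans recovers (cong (toℕ a ,_) 1+w≡b))
    where
    a<w : toℕ a < toℕ w
    a<w = ≤∧≢⇒< (s≤s⁻¹ (subst (toℕ a <_) (sym 1+w≡b) a<b)) a≢w

  toFin : ∀ {x} → x < M → ∃ λ (f : Fin M) → toℕ f ≡ x
  toFin x<M = fromℕ< x<M , toℕ-fromℕ< x<M

  predecessor : ∀ {v : Fin M} → 0 < offset ls (toℕ v) → ∃ λ (w : Fin M) →
    suc (toℕ w) ≡ toℕ v × block ls (toℕ w) ≡ block ls (toℕ v) × offset ls (toℕ v) ≡ suc (offset ls (toℕ w))
  predecessor {v} 0<offset with offset-suc⁻¹ ls (sym (suc-pred _ {{>-nonZero 0<offset}}))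
  ... | w , v≡1+w , same , offset-w with toFin (<-trans (subst (w <_) (sym v≡1+w) (n<1+n w)) (toℕ<n v))
  ...   | w′ , refl = w′ , sym v≡1+w , same ,
                      trans (sym (suc-pred _ {{>-nonZero 0<offset}})) (cong suc (sym offset-w))

  hasNext-intro : ∀ {d} → suc d < M → block ls (suc d) ≡ block ls d → hasNext d ≡ true
  hasNext-intro {d} 1+d<M same rewrite Equivalence.to T-≡ (<⇒<ᵇ 1+d<M) = ≡⇒≡ᵇ-true same

  hasNext-elim : ∀ {d} → hasNext d ≡ true → suc d < M × block ls (suc d) ≡ block ls d
  hasNext-elim {d} next with Equivalence.to T-∧ (Equivalence.from T-≡ next)
  ... | 1+d<ᵇM , sameᵇ = <ᵇ⇒< (suc d) M 1+d<ᵇM , ≡ᵇ⇒≡ _ _ sameᵇ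

  partner-sameBlock : ∀ {a b} (a<b : toℕ a < toℕ b) → evenWeight (toℕ a) (toℕ b) ≡ false →
                      block ls (toℕ a) ≡ block ls (toℕ b) → Partner ((a , b) , a<b)
  partner-sameBlock {a} {b} a<b odd-ab same with predecessor {b} (≤-<-trans z≤n offset-a<offset-b)
    where
    offset-a<offset-b : offset ls (toℕ a) < offset ls (toℕ b)
    offset-a<offset-b = ≰⇒> λ b≤a → <⇒≢ (+-mono-<-≤ a<b b≤a) (offset-translate ls same)
  ... | w , 1+w≡b , same-w , offset-b = lowerHigh a<b odd-ab w 1+w≡b same-w a≢w recovers
    where
    a≢w : toℕ a ≢ toℕ w
    a≢w a≡w =
      contradiction (trans (sym odd-ab) (trans (cong even weight-ab) (even-+-suc-+-1 (offset ls (toℕ a))))) λ ()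
      where
      weight-ab : weight ls (toℕ a) (toℕ b) ≡ offset ls (toℕ a) + suc (offset ls (toℕ a)) + 1
      weight-ab = cong₂ (λ x y → offset ls (toℕ a) + x + 𝟙 y)
                        (trans offset-b (cong (suc ∘ offset ls) (sym a≡w))) (≡⇒≡ᵇ-true same)
    recovers : recover (toℕ a) (toℕ w) ≡ (toℕ a , suc (toℕ w))
    recovers rewrite ≡⇒≡ᵇ-true (trans same (sym same-w)) = refl

  partner-oddHigh : ∀ {a b} (a<b : toℕ a < toℕ b) → evenWeight (toℕ a) (toℕ b) ≡ false →
    block ls (toℕ a) ≢ block ls (toℕ b) → even (offset ls (toℕ b)) ≡ false → Partner ((a , b) , a<b)
  partner-oddHigh {a} {b} a<b odd-ab diff odd-b with predecessor {b} (odd⇒0< odd-b)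
  ... | w , 1+w≡b , same-w , offset-b =
    lowerHigh a<b odd-ab w 1+w≡b same-w (λ a≡w → diff (trans (cong (block ls) a≡w) same-w)) recovers
    where
    recovers : recover (toℕ a) (toℕ w) ≡ (toℕ a , suc (toℕ w))
    recovers rewrite ≢⇒≡ᵇ-false (λ a~w → diff (trans a~w same-w))
                   | not-injective {even (offset ls (toℕ w))} {true} (trans (cong even (sym offset-b)) odd-b)
                   | hasNext-intro (subst (_< M) (sym 1+w≡b) (toℕ<n b)) (trans (cong (block ls) 1+w≡b) (sym same-w))
                   = refl

  partner-raiseHigh : ∀ {a b} (a<b : toℕ a < toℕ b) → evenWeight (toℕ a) (toℕ b) ≡ false →
    block ls (toℕ a) ≢ block ls (toℕ b) → even (offset ls (toℕ b)) ≡ true → hasNext (toℕ b) ≡ true →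
    Partner ((a , b) , a<b)
  partner-raiseHigh {a} {b} a<b odd-ab diff even-b next with hasNext-elim next
  ... | 1+b<M , same with toFin 1+b<M
  ...   | b′ , b′≡1+b =
    highMove a<b a<b′ (consecutive⇒G (inj₁ (sym b′≡1+b)) (sym (trans (cong (block ls) b′≡1+b) same)))
             odd-ab recovers
    where
    a<b′ : toℕ a < toℕ b′
    a<b′ = <-trans a<b (subst (toℕ b <_) (sym b′≡1+b) (n<1+n _))
    recovers : recover (toℕ a) (toℕ b′) ≡ (toℕ a , toℕ b)
    recovers rewrite b′≡1+b
                   | ≢⇒≡ᵇ-false (λ a~b′ → diff (trans a~b′ same))
                   | offset-suc ls (sym same)
                   | even-b
                   = refl

  partner-lowerLow : ∀ {a b} (a<b : toℕ a < toℕ b) → evenWeight (toℕ a) (toℕ b) ≡ false →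
    block ls (toℕ a) ≢ block ls (toℕ b) → even (offset ls (toℕ b)) ≡ true → hasNext (toℕ b) ≡ false →
    Partner ((a , b) , a<b)
  partner-lowerLow {a} {b} a<b odd-ab diff even-b last with predecessor {a} (odd⇒0< odd-a)
    where
    odd-a : even (offset ls (toℕ a)) ≡ false
    odd-a = begin
      even x                ≡⟨ even-+-even x even-b ⟨
      even (x + y)          ≡⟨ cong even (+-identityʳ (x + y)) ⟨
      even (x + y + 𝟙 false) ≡⟨ cong (λ z → even (x + y + 𝟙 z)) (≢⇒≡ᵇ-false diff) ⟨
      evenWeight (toℕ a) (toℕ b) ≡⟨ odd-ab ⟩
      false                 ∎
      where
      open ≡-Reasoning
      x = offset ls (toℕ a)
      y = offset ls (toℕ b)
  ... | c , 1+c≡a , same-c , _ =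
    lowMove a<b c<b (consecutive⇒G (inj₂ 1+c≡a) (sym same-c)) odd-ab (trans recovers (cong (_, toℕ b) 1+c≡a))
    where
    c<b : toℕ c < toℕ b
    c<b = <-trans (subst (toℕ c <_) 1+c≡a (n<1+n _)) a<b
    recovers : recover (toℕ c) (toℕ b) ≡ (suc (toℕ c) , toℕ b)
    recovers rewrite ≢⇒≡ᵇ-false (λ c~b → diff (trans (sym same-c) c~b)) | even-b | last = refl

  -- b moves one step down its path if a lies on the same path or b sits at an odd position;
  -- otherwise a sits at an odd position, and b moves up unless it ends its path, when a moves down.
  partnerOfOdd : ∀ {a b} (a<b : toℕ a < toℕ b) → evenWeight (toℕ a) (toℕ b) ≡ false →
                 Partner ((a , b) , a<b)
  partnerOfOdd {a} {b} a<b odd-ab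
    with block ls (toℕ a) ≟ block ls (toℕ b) | even (offset ls (toℕ b)) in parity-b | hasNext (toℕ b) in next
  ... | yes same | _     | _     = partner-sameBlock a<b odd-ab same
  ... | no  diff | false | _     = partner-oddHigh a<b odd-ab diff parity-b
  ... | no  diff | true  | true  = partner-raiseHigh a<b odd-ab diff parity-b next
  ... | no  diff | true  | false = partner-lowerLow a<b odd-ab diff parity-b next

  Pair2-≡ : ∀ {A B : Pair2 M} → low A ≡ low B → high A ≡ high B → A ≡ B
  Pair2-≡ {(a , b) , a<b} {(a′ , b′) , a′<b′} a≡a′ b≡b′
    with toℕ-injective a≡a′ | toℕ-injective b≡b′
  ... | refl | refl = cong ((a , b) ,_) (<-irrelevant a<b a′<b′)

  oddPairMatching : ComplementMatching (F2 G) EvenPair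
  oddPairMatching = record
    { partner           = λ A ¬even → Partner.pair (partner A ¬even)
    ; partner-∈         = λ A ¬even → Partner.isEven (partner A ¬even)
    ; partner-adjacent  = λ A ¬even → Partner.adjacent (partner A ¬even)
    ; partner-injective = injective
    }
    where
    partner : ∀ A → ¬ EvenPair A → Partner A
    partner ((a , b) , a<b) ¬even = partnerOfOdd a<b (¬T⇒≡false ¬even)
    injective : ∀ A B ¬evenA ¬evenB →
                Partner.pair (partner A ¬evenA) ≡ Partner.pair (partner B ¬evenB) → A ≡ B
    injective A B ¬evenA ¬evenB same-pair = Pair2-≡ (cong proj₁ labels) (cong proj₂ labels)
      where
      labels : (low A , high A) ≡ (low B , high B)
      labels = trans (sym (Partner.recovers (partner A ¬evenA)))
                     (trans (cong (λ P → recover (low P) (high P)) same-pair)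
                            (Partner.recovers (partner B ¬evenB)))

-- Counting the even-weight pairs

sumTo-𝟙-even-+ : ∀ m n (p : ℕ → ℕ) →
  sumTo m (λ a → sumTo n (λ b → 𝟙 (even (a + p b)))) ≡
  evensBelow m * sumTo n (λ b → 𝟙 (even (p b))) + oddsBelow m * sumTo n (λ b → 𝟙 (odd (p b)))
sumTo-𝟙-even-+ m n p = begin
  sumTo m (λ a → sumTo n (λ b → 𝟙 (even (a + p b))))
    ≡⟨ sumTo-cong m (λ {a} _ → trans (sumTo-cong n (λ {b} _ → 𝟙-even-+ a (p b)))
                                     (trans (sumTo-+ n _ _)
                                            (cong₂ _+_ (sumTo-*ˡ n (𝟙 (even a)) (λ b → 𝟙 (even (p b))))
                                                       (sumTo-*ˡ n (𝟙 (odd a)) (λ b → 𝟙 (odd (p b))))))) ⟩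
  sumTo m (λ a → 𝟙 (even a) * E + 𝟙 (odd a) * O)
    ≡⟨ trans (sumTo-+ m _ _) (cong₂ _+_ (sumTo-*ʳ m E _) (sumTo-*ʳ m O _)) ⟩
  evensBelow m * E + oddsBelow m * O ∎
  where
  open ≡-Reasoning
  E = sumTo n (λ b → 𝟙 (even (p b)))
  O = sumTo n (λ b → 𝟙 (odd (p b)))

evenWeightPairs evenOffsets oddOffsets : List ℕ → ℕ
evenWeightPairs ls = countPairs (sum ls) (λ a b → even (weight ls a b))
evenOffsets ls = sumTo (sum ls) (λ v → 𝟙 (even (offset ls v)))
oddOffsets  ls = sumTo (sum ls) (λ v → 𝟙 (odd (offset ls v)))

evenOffsets+oddOffsets : ∀ ls → evenOffsets ls + oddOffsets ls ≡ sum ls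
evenOffsets+oddOffsets ls = sumTo-𝟙+𝟙-not (sum ls) (λ v → even (offset ls v))

module _ (i : ℕ) (is : List ℕ) where

  sumTo-offset-∷ : ∀ (f : ℕ → ℕ) → sumTo (sum (i ∷ is)) (λ v → f (offset (i ∷ is) v)) ≡
                   sumTo i f + sumTo (sum is) (λ v → f (offset is v))
  sumTo-offset-∷ f = trans (sumTo-split i (sum is) _)
    (cong₂ _+_ (sumTo-cong i (λ v<i → cong f (offset-< v<i)))
               (sumTo-cong (sum is) (λ {v} _ → cong f (offset-+ i is v))))

  evenOffsets-∷ : evenOffsets (i ∷ is) ≡ evensBelow i + evenOffsets is
  evenOffsets-∷ = sumTo-offset-∷ (λ k → 𝟙 (even k))

  oddOffsets-∷ : oddOffsets (i ∷ is) ≡ oddsBelow i + oddOffsets is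
  oddOffsets-∷ = sumTo-offset-∷ (λ k → 𝟙 (odd k))

  evenWeightPairs-∷ : evenWeightPairs (i ∷ is) ≡
    evenWeightPathPairs i + (evensBelow i * evenOffsets is + oddsBelow i * oddOffsets is) + evenWeightPairs is
  evenWeightPairs-∷ = trans (countPairs-split i (sum is) _) (cong₂ _+_ (cong₂ _+_ first-block across) rest)
    where
    first-block : countPairs i (λ a b → even (weight (i ∷ is) a b)) ≡ evenWeightPathPairs i
    first-block = countPairs-cong i λ {a} {b} a<b b<i →
      let a<i = <-trans a<b b<i in
      cong even (cong₂ _+_ (cong₂ _+_ (offset-< a<i) (offset-< b<i))
                           (cong 𝟙 (≡⇒≡ᵇ-true (trans (block-< a<i) (sym (block-< b<i))))))
    across : sumTo i (λ a → sumTo (sum is) (λ b → 𝟙 (even (weight (i ∷ is) a (i + b))))) ≡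
             evensBelow i * evenOffsets is + oddsBelow i * oddOffsets is
    across = trans (sumTo-cong i λ {a} a<i → sumTo-cong (sum is) λ {b} _ →
                      cong (λ x → 𝟙 (even x))
                           (trans (cong₂ _+_ (cong₂ _+_ (offset-< a<i) (offset-+ i is b))
                                             (cong 𝟙 (≢⇒≡ᵇ-false (block-<≢block-+ b a<i))))
                                  (+-identityʳ _)))
                   (sumTo-𝟙-even-+ i (sum is) (offset is))
    rest : countPairs (sum is) (λ a b → even (weight (i ∷ is) (i + a) (i + b))) ≡ evenWeightPairs is
    rest = countPairs-cong (sum is) λ {a} {b} _ _ →
      cong even (cong₂ _+_ (cong₂ _+_ (offset-+ i is a) (offset-+ i is b))
                           (cong 𝟙 (cong₂ _≡ᵇ_ (block-+ i is a) (block-+ i is b))))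

evenOffsets≡oddOffsets+numOdd : ∀ ls → evenOffsets ls ≡ oddOffsets ls + numOdd ls
evenOffsets≡oddOffsets+numOdd []       = refl
evenOffsets≡oddOffsets+numOdd (i ∷ is) = begin
  evenOffsets (i ∷ is)                  ≡⟨ evenOffsets-∷ i is ⟩
  evensBelow i + evenOffsets is
    ≡⟨ cong₂ _+_ (evensBelow≡oddsBelow+𝟙-odd i) (evenOffsets≡oddOffsets+numOdd is) ⟩
  oddsBelow i + δ + (O + t)             ≡⟨ +-interchange (oddsBelow i) δ O t ⟩
  oddsBelow i + O + (δ + t)             ≡⟨ cong₂ _+_ (oddOffsets-∷ i is) (numOdd-∷ i is) ⟨
  oddOffsets (i ∷ is) + numOdd (i ∷ is) ∎
  where
  open ≡-Reasoning
  δ = 𝟙 (odd i)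
  O = oddOffsets is
  t = numOdd is

-- The evens and odds of a single path differ by its parity bit δ, and δ * δ = δ.
evens-odds-identity : ∀ n → 2 * (evensBelow n * oddsBelow n) + 𝟙 (odd n) ≡
                            evensBelow n * evensBelow n + oddsBelow n * oddsBelow n
evens-odds-identity n rewrite evensBelow≡oddsBelow+𝟙-odd n with odd n
... | true  = identity₁ (oddsBelow n)
  where
  identity₁ : ∀ o → 2 * ((o + 1) * o) + 1 ≡ (o + 1) * (o + 1) + o * o
  identity₁ = solve-∀
... | false = identity₀ (oddsBelow n)
  where
  identity₀ : ∀ o → 2 * ((o + 0) * o) + 0 ≡ (o + 0) * (o + 0) + o * o
  identity₀ = solve-∀

2*evenWeightPairs+numOdd : ∀ ls → 2 * evenWeightPairs ls + numOdd ls ≡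
                                  evenOffsets ls * evenOffsets ls + oddOffsets ls * oddOffsets ls
2*evenWeightPairs+numOdd []       = refl
2*evenWeightPairs+numOdd (i ∷ is) = begin
  2 * evenWeightPairs (i ∷ is) + numOdd (i ∷ is)
    ≡⟨ cong₂ (λ x y → 2 * x + y) (evenWeightPairs-∷ i is) (numOdd-∷ i is) ⟩
  2 * (evenWeightPathPairs i + (e * E + o * O) + I) + (δ + t)
    ≡⟨ cong (λ x → 2 * (x + (e * E + o * O) + I) + (δ + t)) (evenWeightPathPairs≡evens*odds i) ⟩
  2 * (e * o + (e * E + o * O) + I) + (δ + t)
    ≡⟨ regroup e o δ E O I t ⟩
  (2 * (e * o) + δ) + 2 * (e * E + o * O) + (2 * I + t)
    ≡⟨ cong₂ (λ x y → x + 2 * (e * E + o * O) + y) (evens-odds-identity i) (2*evenWeightPairs+numOdd is) ⟩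
  (e * e + o * o) + 2 * (e * E + o * O) + (E * E + O * O)
    ≡⟨ squares e o E O ⟩
  (e + E) * (e + E) + (o + O) * (o + O)
    ≡⟨ cong₂ (λ x y → x * x + y * y) (evenOffsets-∷ i is) (oddOffsets-∷ i is) ⟨
  evenOffsets (i ∷ is) * evenOffsets (i ∷ is) + oddOffsets (i ∷ is) * oddOffsets (i ∷ is) ∎
  where
  open ≡-Reasoning
  e = evensBelow i
  o = oddsBelow i
  δ = 𝟙 (odd i)
  E = evenOffsets is
  O = oddOffsets is
  I = evenWeightPairs is
  t = numOdd is
  regroup : ∀ e o δ E O I t → 2 * (e * o + (e * E + o * O) + I) + (δ + t) ≡
                              (2 * (e * o) + δ) + 2 * (e * E + o * O) + (2 * I + t)
  regroup = solve-∀
  squares : ∀ e o E O → (e * e + o * o) + 2 * (e * E + o * O) + (E * E + O * O) ≡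
                        (e + E) * (e + E) + (o + O) * (o + O)
  squares = solve-∀

4*evenWeightPairs+2*numOdd : ∀ ls →
  4 * evenWeightPairs ls + 2 * numOdd ls ≡ sum ls * sum ls + numOdd ls * numOdd ls
4*evenWeightPairs+2*numOdd ls = begin
  4 * I + 2 * t                        ≡⟨ double I t ⟩
  2 * (2 * I + t)                      ≡⟨ cong (2 *_) (2*evenWeightPairs+numOdd ls) ⟩
  2 * (E * E + O * O)                  ≡⟨ cong (λ x → 2 * (x * x + O * O)) E≡O+t ⟩
  2 * ((O + t) * (O + t) + O * O)      ≡⟨ squares O t ⟩
  (O + t + O) * (O + t + O) + t * t    ≡⟨ cong (λ x → x * x + t * t) m≡O+t+O ⟨
  sum ls * sum ls + t * t              ∎
  where
  open ≡-Reasoning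
  I = evenWeightPairs ls
  t = numOdd ls
  E = evenOffsets ls
  O = oddOffsets ls
  E≡O+t = evenOffsets≡oddOffsets+numOdd ls
  m≡O+t+O : sum ls ≡ O + t + O
  m≡O+t+O = trans (sym (evenOffsets+oddOffsets ls)) (cong (_+ O) E≡O+t)
  double : ∀ I t → 4 * I + 2 * t ≡ 2 * (2 * I + t)
  double = solve-∀
  squares : ∀ O t → 2 * ((O + t) * (O + t) + O * O) ≡ (O + t + O) * (O + t + O) + t * t
  squares = solve-∀

theorem4 : (m : ℕ) → 2 ≤ m → (ls : List ℕ) → All (λ i → 1 ≤ i) ls → sum ls ≡ m →
    ∃ λ (α : ℕ) → IsIndependenceNumber (F2 (PathUnion m ls)) α
      × 4 * α ≡ m * m + numOdd ls * numOdd ls ∸ 2 * numOdd ls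
theorem4 .(sum ls) _ ls _ refl = evenWeightPairs ls , α-is-evenWeightPairs , formula
  where
  open PathUnionTokens ls
  α-is-evenWeightPairs : IsIndependenceNumber (F2 G) (evenWeightPairs ls)
  α-is-evenWeightPairs =
    subst (IsIndependenceNumber (F2 G)) (length-filter-allPairs M evenWeight)
          (independenceNumber-matched (T? ∘ onLabels evenWeight)
                                      (allPairs M) (allPairs-Unique M) (∈-allPairs M)
                                      (λ {A} {B} → EvenPair-independent {A} {B}) oddPairMatching)
  formula : 4 * evenWeightPairs ls ≡ M * M + numOdd ls * numOdd ls ∸ 2 * numOdd ls
  formula = sym (trans (cong (_∸ 2 * numOdd ls) (sym (4*evenWeightPairs+2*numOdd ls)))
                       (m+n∸n≡m _ (2 * numOdd ls)))
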